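{- For each integer $n\ge1$, let $d_n=\dim\mathrm{Prim}(\mathbf{ISPW})_n$. There exists a basis $(e_1,\dots,e_{d_n})$ of $\mathrm{Prim}(\mathbf{ISPW})_n$ such that for every $i\in\{1,\dots,d_n\}$ there is a unique partition $(\alpha_1\le\dots\le\alpha_{k_i})$ of $n$ with $$e_i\in\mathrm{Vect}\big(W_{(\alpha_{\sigma(1)},\dots,\alpha_{\sigma(k_i)})}:\sigma\in\mathfrak{S}_{k_i}\big).$$
   Context: $\mathbb{K}$ is a field of characteristic $0$. For a composition $\alpha=(\alpha_1,\dots,\alpha_k)$ (positive integers, $k\ge0$) let $W_\alpha$ denote the word $x_1^{\alpha_1}x_2^{\alpha_2}\cdots x_k^{\alpha_k}$ ($\alpha_1$ letters $x_1$, then $\alpha_2$ letters $x_2$, etc.; $W_{()}=1$). $\mathbf{ISPW}$ (Hopf algebra of increasing strict packed words) is the vector space with basis $(W_\alpha)$, graded by $|\alpha|=\alpha_1+\dots+\alpha_k$, with product $W_\alpha\ast W_\beta=W_{\alpha\beta}$ (concatenation of compositions, i.e. shifted concatenation of words) and coproduct $\Delta(W_{(\alpha_1,\dots,\alpha_k)})=\sum_{I\sqcup U=\{1,\dots,k\}}W_{(\alpha_{i_1},\dots,\alpha_{i_p})}\otimes W_{(\alpha_{u_1},\dots,\alpha_{u_s})}$, where $I=\{i_1<\dots<i_p\}$, $U=\{u_1<\dots<u_s\}$. (It arises as a Hopf subalgebra of the quotient of the packed words Hopf algebra by the ideal spanned by packed words containing $x_0$.) $\mathrm{Prim}(\mathbf{ISPW})_n$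 denotes the primitive elements of degree $n$. -}

module Defs where

open import Level using (Level; _⊔_; suc)
open import Algebra.Bundles using (CommutativeRing)
open import Data.Nat as ℕ using (ℕ; zero; _≤_)
open import Data.List using (List; []; _∷_; _++_; map; concatMap; allFin)
open import Data.Nat.ListAction using (sum)
import Data.List.Properties as LP
import Data.Nat.Properties as NP
import Data.Product.Properties as PP
open import Data.List.Relation.Unary.Linked using (Linked)
open import Data.List.Relation.Binary.Permutation.Propositional using (_↭_)
open import Data.Fin using (Fin)
open import Data.Product using (_×_; _,_; ∃; ∃-syntax; Σ)
open import Relation.Nullary using (¬_; yes; no)
open import Relation.Binary.PropositionalEquality using (_≡_)
open import Relation.Binary.Definitions using (DecidableEquality)

record Field (c ℓ : Level) : Set (Level.suc (c ⊔ ℓ)) where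
  field
    commutativeRing : CommutativeRing c ℓ
  open CommutativeRing commutativeRing public
  field
    0≉1     : ¬ (0# ≈ 1#)
    inverse : ∀ x → ¬ (x ≈ 0#) → ∃[ y ] (x * y ≈ 1#)

  fromℕ : ℕ → Carrier
  fromℕ zero       = 0#
  fromℕ (ℕ.suc m) = 1# + fromℕ m

CharZero : ∀ {c ℓ} → Field c ℓ → Set ℓ
CharZero F = ∀ m → ¬ (fromℕ (ℕ.suc m) ≈ 0#)
  where open Field F

-- Compositions.  A composition (α₁,…,αₖ) of positive integers is
-- encoded as a list (a₁,…,aₖ) of naturals with αᵢ = aᵢ + 1
-- (a bijection between List ℕ and compositions).

Comp : Set
Comp = List ℕ

weight : Comp → ℕ
weight α = sum (map ℕ.suc α)

IsPartitionOf : Comp → ℕ → Set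
IsPartitionOf p n = Linked _≤_ p × weight p ≡ n

-- all splittings (α|_I , α|_U) over I ⊔ U = {1,…,k}, with multiplicity
splits : Comp → List (Comp × Comp)
splits []      = ([] , []) ∷ []
splits (a ∷ α) = concatMap (λ { (l , r) → (a ∷ l , r) ∷ (l , a ∷ r) ∷ [] }) (splits α)

_≟C_ : DecidableEquality Comp
_≟C_ = LP.≡-dec NP._≟_

_≟T_ : DecidableEquality (Comp × Comp)
_≟T_ = PP.≡-dec _≟C_ _≟C_

-- ISPW over a field K, as the free K-module on the basis (W_α),
-- elements being formal finite sums  Σ c · W_α  (lists of pairs),
-- and ISPW ⊗ ISPW as the free module on pairs (W_β ⊗ W_γ).

module ISPW {c ℓ} (K : Field c ℓ) where
  open Field K

  Elt : Set c
  Elt = List (Carrier × Comp)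

  Elt⊗ : Set c
  Elt⊗ = List (Carrier × (Comp × Comp))

  coeff : Elt → Comp → Carrier
  coeff []             α = 0#
  coeff ((a , β) ∷ x) α with β ≟C α
  ... | yes _ = a + coeff x α
  ... | no  _ = coeff x α

  coeff⊗ : Elt⊗ → Comp × Comp → Carrier
  coeff⊗ []             p = 0#
  coeff⊗ ((a , q) ∷ t) p with q ≟T p
  ... | yes _ = a + coeff⊗ t p
  ... | no  _ = coeff⊗ t p

  _≈E_ : Elt → Elt → Set ℓ
  x ≈E y = ∀ α → coeff x α ≈ coeff y α

  _≈⊗_ : Elt⊗ → Elt⊗ → Set ℓ
  s ≈⊗ t = ∀ p → coeff⊗ s p ≈ coeff⊗ t p

  W : Comp → Elt
  W α = (1# , α) ∷ []

  zeroE : Elt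
  zeroE = []

  _·_ : Carrier → Elt → Elt
  a · x = map (λ { (b , α) → (a * b , α) }) x

  lincomb : ∀ {d} → (Fin d → Carrier) → (Fin d → Elt) → Elt
  lincomb {d} λs e = concatMap (λ i → λs i · e i) (allFin d)

  Homogeneous : ℕ → Elt → Set ℓ
  Homogeneous n x = ∀ α → ¬ (weight α ≡ n) → coeff x α ≈ 0#

  Δ : Elt → Elt⊗
  Δ x = concatMap (λ { (a , α) → map (λ p → (a , p)) (splits α) }) x

  -- x ⊗ 1 + 1 ⊗ x   (1 = W_())
  prim-rhs : Elt → Elt⊗
  prim-rhs x = map (λ { (a , α) → (a , (α , [])) }) x
            ++ map (λ { (a , α) → (a , ([] , α)) }) x

  Primitive : Elt → Set ℓ
  Primitive x = Δ x ≈⊗ prim-rhs x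

  InPrim : ℕ → Elt → Set ℓ
  InPrim n x = Homogeneous n x × Primitive x

  IsBasisOfPrim : ℕ → (d : ℕ) → (Fin d → Elt) → Set (c ⊔ ℓ)
  IsBasisOfPrim n d e =
      (∀ i → InPrim n (e i))
    × (∀ (λs : Fin d → Carrier) → lincomb λs e ≈E zeroE → ∀ i → λs i ≈ 0#)
    × (∀ x → InPrim n x → ∃[ λs ] (x ≈E lincomb λs e))

  InPermSpan : Comp → Elt → Set ℓ
  InPermSpan p x = ∀ α → ¬ (α ↭ p) → coeff x α ≈ 0#

-- Prim(ISPW)_n is the kernel, on the span of the W_α with |α| = n, of the reduced coproduct
-- x ↦ Δ(x) − x ⊗ 1 − 1 ⊗ x.  Its coefficient at W_β ⊗ W_γ is an integer combination of the
-- coordinates of x, so Prim(ISPW)_n is the solution space of a finite homogeneous linear system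
-- with integer coefficients.  Since W_β ⊗ W_γ only occurs in Δ(W_α) when α is a rearrangement of
-- βγ, each equation only involves the rearrangements of a single partition.  Gaussian elimination
-- (pivots are found by testing integers for zero; characteristic 0 makes the nonzero ones
-- invertible in K) never mixes such classes, so every vector of the resulting basis of solutions
-- lives on the rearrangements of one partition.  That partition is unique because basis vectors
-- are nonzero.

module Submission where

open import Defs
open import Level using (_⊔_)
open import Algebra.Bundles using (Semiring)
open import Data.Nat as ℕ using (ℕ; zero; suc; _≤_)
import Data.Nat.Properties as ℕ
open import Data.Nat.ListAction.Properties using (sum-↭)
open import Data.Fin using (Fin; zero; suc; punchIn; _≟_)
open import Data.Fin.Properties using (punchInᵢ≢i)
open import Data.Vec.Functional using (Vector; head; tail)
open import Data.List
  using (List; []; _∷_; _++_; map; concatMap; filter; deduplicate; length; lookup; tabulate)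
open import Data.List.Properties using (++-identityʳ)
open import Data.List.Membership.Propositional using (_∈_; _∉_; find; lose)
open import Data.List.Membership.Propositional.Properties
  using ( ∈-map⁺; ∈-map⁻; ∈-concatMap⁺; ∈-concatMap⁻; ∈-++⁻; ∈-++⁺ˡ; ∈-++⁺ʳ; ∈-filter⁺; ∈-filter⁻
        ; ∈-deduplicate⁺; ∈-deduplicate⁻; ∈-lookup)
open import Data.List.Membership.DecPropositional _≟T_ using (_∈?_)
open import Data.List.Relation.Unary.Any using (here; there; index; any?)
open import Data.List.Relation.Unary.Any.Properties using (lookup-index)
open import Data.List.Relation.Unary.All as All using ()
open import Data.List.Relation.Unary.AllPairs using (_∷_)
open import Data.List.Relation.Unary.Unique.Propositional using (Unique)
open import Data.List.Relation.Unary.Unique.DecPropositional.Properties _≟C_ using (deduplicate-!)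
open import Data.List.Relation.Binary.Permutation.Propositional
  using (_↭_; ↭-refl; ↭-sym; ↭-trans; prep; ↭-reflexive; ↭⇒↭ₛ)
open import Data.List.Relation.Binary.Permutation.Propositional.Properties
  using (shift) renaming (map⁺ to ↭-map⁺)
open import Data.List.Relation.Binary.Pointwise using (Pointwise-≡⇒≡)
open import Data.List.Sort ℕ.≤-decTotalOrder using (sort; sort-↭; sort-↗)
open import Data.List.Relation.Unary.Sorted.TotalOrder ℕ.≤-totalOrder using (Sorted)
open import Data.List.Relation.Unary.Sorted.TotalOrder.Properties using (↗↭↗⇒≋)
open import Data.Product using (_×_; _,_; ∃-syntax; proj₁; proj₂)
open import Data.Sum using ([_,_]′)
open import Data.Empty using (⊥-elim)
open import Function using (_∘_)
open import Relation.Nullary using (¬_; Dec; yes; no; ¬?)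
open import Relation.Nullary.Decidable using (decidable-stable)
open import Relation.Binary.Definitions using (DecidableEquality)
open import Relation.Binary.PropositionalEquality as ≡ using (_≡_; _≢_)

-- An integer p − q, kept as a pair of naturals so that being zero is decidable.
Diff : Set
Diff = ℕ × ℕ

_⊛_ _⊝_ : Diff → Diff → Diff
(p , q) ⊝ (p′ , q′) = p ℕ.+ q′ , q ℕ.+ p′
(p , q) ⊛ (p′ , q′) = p ℕ.* p′ ℕ.+ q ℕ.* q′ , p ℕ.* q′ ℕ.+ q ℕ.* p′

IsZero : Diff → Set
IsZero (p , q) = p ≡ q

isZero? : ∀ z → Dec (IsZero z)
isZero? (p , q) = p ℕ.≟ q

module FieldProperties {c ℓ} (K : Field c ℓ) where
  open Field K
  open import Algebra.Definitions.RawMonoid +-rawMonoid renaming (_×_ to _×ₙ_)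
  open import Algebra.Properties.Monoid.Mult +-monoid using (×-homo-+)
  open import Algebra.Properties.Semiring.Mult semiring using (×1-homo-*)
  open import Algebra.Properties.Ring ring using ([y-z]x≈yx-zx; x[y-z]≈xy-xz)
  open import Algebra.Properties.AbelianGroup +-abelianGroup
    using (⁻¹-∙-comm; ⁻¹-anti-homo‿-; x∙y⁻¹≈ε⇒x≈y; ∙-cancelˡ)
  open import Algebra.Properties.CommutativeSemigroup +-commutativeSemigroup using (interchange)
  open import Relation.Binary.Reasoning.Setoid setoid

  fromℕ≈×1# : ∀ m → fromℕ m ≈ m ×ₙ 1#
  fromℕ≈×1# zero    = refl
  fromℕ≈×1# (suc m) = +-congˡ (fromℕ≈×1# m)

  fromℕ-homo-+ : ∀ m n → fromℕ (m ℕ.+ n) ≈ fromℕ m + fromℕ n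
  fromℕ-homo-+ m n = begin
    fromℕ (m ℕ.+ n)     ≈⟨ fromℕ≈×1# (m ℕ.+ n) ⟩
    (m ℕ.+ n) ×ₙ 1#     ≈⟨ ×-homo-+ 1# m n ⟩
    m ×ₙ 1# + n ×ₙ 1#   ≈⟨ +-cong (fromℕ≈×1# m) (fromℕ≈×1# n) ⟨
    fromℕ m + fromℕ n   ∎

  fromℕ-homo-* : ∀ m n → fromℕ (m ℕ.* n) ≈ fromℕ m * fromℕ n
  fromℕ-homo-* m n = begin
    fromℕ (m ℕ.* n)         ≈⟨ fromℕ≈×1# (m ℕ.* n) ⟩
    (m ℕ.* n) ×ₙ 1#         ≈⟨ ×1-homo-* m n ⟩
    (m ×ₙ 1#) * (n ×ₙ 1#)   ≈⟨ *-cong (fromℕ≈×1# m) (fromℕ≈×1# n) ⟨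
    fromℕ m * fromℕ n       ∎

  fromℕ-injective : CharZero K → ∀ {m n} → fromℕ m ≈ fromℕ n → m ≡ n
  fromℕ-injective cz {zero}  {zero}  _ = ≡.refl
  fromℕ-injective cz {zero}  {suc n} e = ⊥-elim (cz n (sym e))
  fromℕ-injective cz {suc m} {zero}  e = ⊥-elim (cz m e)
  fromℕ-injective cz {suc m} {suc n} e =
    ≡.cong suc (fromℕ-injective cz (∙-cancelˡ 1# (fromℕ m) (fromℕ n) e))

  x≉0∧x*y≈0⇒y≈0 : ∀ {x y} → ¬ (x ≈ 0#) → x * y ≈ 0# → y ≈ 0#
  x≉0∧x*y≈0⇒y≈0 {x} {y} x≉0 xy≈0 with inverse x x≉0
  ... | x⁻¹ , x*x⁻¹≈1 = begin
    y                ≈⟨ *-identityˡ y ⟨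
    1# * y           ≈⟨ *-congʳ (trans (sym x*x⁻¹≈1) (*-comm x x⁻¹)) ⟩
    (x⁻¹ * x) * y    ≈⟨ *-assoc x⁻¹ x y ⟩
    x⁻¹ * (x * y)    ≈⟨ *-congˡ xy≈0 ⟩
    x⁻¹ * 0#         ≈⟨ zeroʳ x⁻¹ ⟩
    0#               ∎

  𝟙 : ∀ {P : Set} → Dec P → Carrier
  𝟙 (yes _) = 1#
  𝟙 (no  _) = 0#

  𝟙-no : ∀ {P : Set} (P? : Dec P) → ¬ P → 𝟙 P? ≈ 0#
  𝟙-no (yes p) ¬p = ⊥-elim (¬p p)
  𝟙-no (no _)  _  = refl

  𝟙-yes : ∀ {P : Set} (P? : Dec P) → P → 𝟙 P? ≈ 1#
  𝟙-yes (yes _) _ = refl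
  𝟙-yes (no ¬p) p = ⊥-elim (¬p p)

  ⟦_⟧ : Diff → Carrier
  ⟦ p , q ⟧ = fromℕ p - fromℕ q

  private
    [a-b]+[c-d]≈[a+c]-[b+d] : ∀ a b c d → (a - b) + (c - d) ≈ (a + c) - (b + d)
    [a-b]+[c-d]≈[a+c]-[b+d] a b c d = begin
      (a - b) + (c - d)     ≈⟨ interchange a (- b) c (- d) ⟩
      (a + c) + (- b + - d) ≈⟨ +-congˡ (⁻¹-∙-comm b d) ⟩
      (a + c) - (b + d)     ∎

    [a-b]-[c-d]≈[a+d]-[b+c] : ∀ a b c d → (a - b) - (c - d) ≈ (a + d) - (b + c)
    [a-b]-[c-d]≈[a+d]-[b+c] a b c d = begin
      (a - b) - (c - d)     ≈⟨ +-congˡ (⁻¹-anti-homo‿- c d) ⟩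
      (a - b) + (d - c)     ≈⟨ [a-b]+[c-d]≈[a+c]-[b+d] a b d c ⟩
      (a + d) - (b + c)     ∎

  ⟦⟧-homo-- : ∀ x y → ⟦ x ⊝ y ⟧ ≈ ⟦ x ⟧ - ⟦ y ⟧
  ⟦⟧-homo-- (p , q) (p′ , q′) = begin
    fromℕ (p ℕ.+ q′) - fromℕ (q ℕ.+ p′)
      ≈⟨ +-cong (fromℕ-homo-+ p q′) (-‿cong (fromℕ-homo-+ q p′)) ⟩
    (fromℕ p + fromℕ q′) - (fromℕ q + fromℕ p′)
      ≈⟨ [a-b]-[c-d]≈[a+d]-[b+c] _ _ _ _ ⟨
    (fromℕ p - fromℕ q) - (fromℕ p′ - fromℕ q′) ∎

  ⟦⟧-homo-* : ∀ x y → ⟦ x ⊛ y ⟧ ≈ ⟦ x ⟧ * ⟦ y ⟧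
  ⟦⟧-homo-* (p , q) (p′ , q′) = begin
    fromℕ (p ℕ.* p′ ℕ.+ q ℕ.* q′) - fromℕ (p ℕ.* q′ ℕ.+ q ℕ.* p′)
      ≈⟨ +-cong (fromℕ-+* p p′ q q′) (-‿cong (fromℕ-+* p q′ q p′)) ⟩
    (P * P′ + Q * Q′) - (P * Q′ + Q * P′)
      ≈⟨ [a-b]-[c-d]≈[a+d]-[b+c] _ _ _ _ ⟨
    (P * P′ - P * Q′) - (Q * P′ - Q * Q′)
      ≈⟨ +-cong (x[y-z]≈xy-xz P P′ Q′) (-‿cong (x[y-z]≈xy-xz Q P′ Q′)) ⟨
    P * (P′ - Q′) - Q * (P′ - Q′)
      ≈⟨ [y-z]x≈yx-zx (P′ - Q′) P Q ⟨
    (P - Q) * (P′ - Q′) ∎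
    where
    P Q P′ Q′ : Carrier
    P  = fromℕ p
    Q  = fromℕ q
    P′ = fromℕ p′
    Q′ = fromℕ q′
    fromℕ-+* : ∀ a b c d → fromℕ (a ℕ.* b ℕ.+ c ℕ.* d) ≈ fromℕ a * fromℕ b + fromℕ c * fromℕ d
    fromℕ-+* a b c d = trans (fromℕ-homo-+ (a ℕ.* b) (c ℕ.* d)) (+-cong (fromℕ-homo-* a b) (fromℕ-homo-* c d))

  ⟦⟧-zero : ∀ {z} → IsZero z → ⟦ z ⟧ ≈ 0#
  ⟦⟧-zero {p , .p} ≡.refl = -‿inverseʳ (fromℕ p)

  ⟦⟧-nonzero : CharZero K → ∀ {z} → ¬ IsZero z → ¬ (⟦ z ⟧ ≈ 0#)
  ⟦⟧-nonzero cz {p , q} p≢q e = p≢q (fromℕ-injective cz (x∙y⁻¹≈ε⇒x≈y _ _ e))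

module SumProperties {c ℓ} (R : Semiring c ℓ) where
  open Semiring R
  open import Algebra.Properties.Semiring.Sum R public
  open import Relation.Binary.Reasoning.Setoid setoid

  sum-zero : ∀ {m} {f : Vector Carrier m} → (∀ j → f j ≈ 0#) → sum f ≈ 0#
  sum-zero {m} f≈0 = trans (sum-cong-≋ f≈0) (sum-replicate-zero m)

  sum-δ : ∀ {m} (f : Vector Carrier m) j₀ → (∀ j → j ≢ j₀ → f j ≈ 0#) → sum f ≈ f j₀
  sum-δ {suc m} f j₀ f≈0 = begin
    sum f                                ≈⟨ sum-remove f ⟩
    f j₀ + sum (λ k → f (punchIn j₀ k))  ≈⟨ +-congˡ (sum-zero (λ k → f≈0 _ (punchInᵢ≢i j₀ k))) ⟩
    f j₀ + 0#                            ≈⟨ +-identityʳ (f j₀) ⟩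
    f j₀                                 ∎

  ∑-linear : ∀ {m} x y (f g : Vector Carrier m) →
             ∑[ j < m ] (x * f j + y * g j) ≈ x * sum f + y * sum g
  ∑-linear {m} x y f g = begin
    ∑[ j < m ] (x * f j + y * g j)              ≈⟨ ∑-distrib-+ (λ j → x * f j) (λ j → y * g j) ⟩
    ∑[ j < m ] (x * f j) + ∑[ j < m ] (y * g j) ≈⟨ +-cong (*-distribˡ-sum x f) (*-distribˡ-sum y g) ⟨
    x * sum f + y * sum g                        ∎

module LinearSystems {c ℓ} (K : Field c ℓ) (cz : CharZero K)
                     {A : Set} (_≟A_ : DecidableEquality A) where
  open Field K hiding (zero)
  open FieldProperties K
  open SumProperties semiring
  open import Algebra.Properties.Ring ring
    using (-‿distribˡ-*; -‿distribʳ-*; -1*x≈-x; +-inverseˡ-unique; -0#≈0#)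
  open import Algebra.Properties.CommutativeSemigroup *-commutativeSemigroup
    using () renaming (x∙yz≈y∙xz to x*[y*z]≈y*[x*z])
  open import Relation.Binary.Reasoning.Setoid setoid

  Equation : ℕ → Set
  Equation m = Vector Diff m

  infix 8 _⊙_
  _⊙_ : ∀ {m} → Equation m → Vector Carrier m → Carrier
  _⊙_ {m} e v = ∑[ j < m ] (⟦ e j ⟧ * v j)

  Solves : ∀ {m} → List (Equation m) → Vector Carrier m → Set ℓ
  Solves E v = ∀ {e} → e ∈ E → e ⊙ v ≈ 0#

  combination : ∀ {d m} → Vector Carrier d → (Fin d → Vector Carrier m) → Vector Carrier m
  combination {d} λs b j = ∑[ i < d ] (λs i * b i j)

  SupportedOn : ∀ {m} → Vector A m → A → Vector Carrier m → Set ℓ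
  SupportedOn cl κ v = ∀ j → cl j ≢ κ → v j ≈ 0#

  record SolutionBasis {m} (cl : Vector A m) (E : List (Equation m)) : Set (c ⊔ ℓ) where
    field
      dim         : ℕ
      basis       : Fin dim → Vector Carrier m
      solves      : ∀ i → Solves E (basis i)
      independent : ∀ λs → (∀ j → combination λs basis j ≈ 0#) → ∀ i → λs i ≈ 0#
      spans       : ∀ v → Solves E v → ∃[ λs ] (∀ j → v j ≈ combination λs basis j)
      supported   : ∀ i → ∃[ j₀ ] SupportedOn cl (cl j₀) (basis i)

  ⊙-combination : ∀ {d m} (e : Equation m) λs (b : Fin d → Vector Carrier m) →
                  e ⊙ combination λs b ≈ ∑[ i < d ] (λs i * e ⊙ b i)
  ⊙-combination {d} {m} e λs b = begin
    ∑[ j < m ] (⟦ e j ⟧ * ∑[ i < d ] (λs i * b i j))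
      ≈⟨ sum-cong-≋ (λ j → *-distribˡ-sum ⟦ e j ⟧ (λ i → λs i * b i j)) ⟩
    ∑[ j < m ] ∑[ i < d ] (⟦ e j ⟧ * (λs i * b i j))
      ≈⟨ ∑-comm (λ j i → ⟦ e j ⟧ * (λs i * b i j)) ⟩
    ∑[ i < d ] ∑[ j < m ] (⟦ e j ⟧ * (λs i * b i j))
      ≈⟨ sum-cong-≋ (λ i → sum-cong-≋ (λ j → x*[y*z]≈y*[x*z] ⟦ e j ⟧ (λs i) (b i j))) ⟩
    ∑[ i < d ] ∑[ j < m ] (λs i * (⟦ e j ⟧ * b i j))
      ≈⟨ sum-cong-≋ (λ i → *-distribˡ-sum (λs i) (λ j → ⟦ e j ⟧ * b i j)) ⟨
    ∑[ i < d ] (λs i * e ⊙ b i) ∎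

  module FreeFirstUnknown {m} (cl : Vector A (suc m)) (E : List (Equation (suc m)))
           (free : ∀ {e} → e ∈ E → IsZero (head e))
           (B : SolutionBasis (tail cl) (map tail E)) where
    open SolutionBasis B

    ⊙-free : ∀ {e} → e ∈ E → ∀ v → e ⊙ v ≈ tail e ⊙ tail v
    ⊙-free e∈E v = trans (+-congʳ (trans (*-congʳ (⟦⟧-zero (free e∈E))) (zeroˡ _))) (+-identityˡ _)

    basis′ : Fin (suc dim) → Vector Carrier (suc m)
    basis′ zero    zero    = 1#
    basis′ zero    (suc j) = 0#
    basis′ (suc i) zero    = 0#
    basis′ (suc i) (suc j) = basis i j

    combination-head : ∀ λs → combination λs basis′ zero ≈ head λs
    combination-head λs = begin
      head λs * 1# + ∑[ i < dim ] (λs (suc i) * 0#)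
        ≈⟨ +-cong (*-identityʳ _) (sum-zero (λ i → zeroʳ (λs (suc i)))) ⟩
      head λs + 0#
        ≈⟨ +-identityʳ _ ⟩
      head λs ∎

    combination-tail : ∀ λs j → combination λs basis′ (suc j) ≈ combination (tail λs) basis j
    combination-tail λs j = trans (+-congʳ (zeroʳ (head λs))) (+-identityˡ _)

    solves′ : ∀ i → Solves E (basis′ i)
    solves′ zero {e} e∈E = trans (⊙-free e∈E (basis′ zero)) (sum-zero (λ j → zeroʳ ⟦ tail e j ⟧))
    solves′ (suc i) e∈E = trans (⊙-free e∈E (basis′ (suc i))) (solves i (∈-map⁺ tail e∈E))

    independent′ : ∀ λs → (∀ j → combination λs basis′ j ≈ 0#) → ∀ i → λs i ≈ 0#
    independent′ λs comb≈0 zero    = trans (sym (combination-head λs)) (comb≈0 zero)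
    independent′ λs comb≈0 (suc i) =
      independent (tail λs) (λ j → trans (sym (combination-tail λs j)) (comb≈0 (suc j))) i

    tail-solves : ∀ {v} → Solves E v → Solves (map tail E) (tail v)
    tail-solves {v} v-solves e′∈ with ∈-map⁻ tail e′∈
    ... | e , e∈E , ≡.refl = trans (sym (⊙-free e∈E v)) (v-solves e∈E)

    spans′ : ∀ v → Solves E v → ∃[ λs ] (∀ j → v j ≈ combination λs basis′ j)
    spans′ v v-solves with spans (tail v) (tail-solves {v} v-solves)
    ... | μ , μ-spans = λs , λ where
        zero    → sym (combination-head λs)
        (suc j) → trans (μ-spans j) (sym (combination-tail λs j))
      where
      λs : Vector Carrier (suc dim)
      λs zero    = head v
      λs (suc i) = μ i

    supported′ : ∀ i → ∃[ j₀ ] SupportedOn cl (cl j₀) (basis′ i)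
    supported′ zero    = zero , λ where
      zero    cl≢ → ⊥-elim (cl≢ ≡.refl)
      (suc j) _   → refl
    supported′ (suc i) = let j₀ , supp = supported i in suc j₀ , λ where
      zero    _   → refl
      (suc j) cl≢ → supp j cl≢

    result : SolutionBasis cl E
    result = record
      { dim = suc dim ; basis = basis′ ; solves = solves′
      ; independent = independent′ ; spans = spans′ ; supported = supported′ }

  class-of-nonzero : ∀ {m} {cl : Vector A m} {κ v} → SupportedOn cl κ v → ∀ j → ¬ (v j ≈ 0#) → cl j ≡ κ
  class-of-nonzero {cl = cl} {κ} supp j vj≉0 with cl j ≟A κ
  ... | yes eq  = eq
  ... | no  neq = ⊥-elim (vj≉0 (supp j neq))

  module EliminateFirstUnknown {m} (cl : Vector A (suc m)) (E : List (Equation (suc m)))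
           (supported-E : ∀ {e} → e ∈ E → ∃[ κ ] SupportedOn cl κ (⟦_⟧ ∘ e))
           {r} (r∈E : r ∈ E) (pivot : ¬ IsZero (head r)) where

    a : Carrier
    a = ⟦ head r ⟧

    a≉0 : ¬ (a ≈ 0#)
    a≉0 = ⟦⟧-nonzero cz pivot

    a⁻¹ : Carrier
    a⁻¹ = proj₁ (inverse a a≉0)

    a*a⁻¹≈1 : a * a⁻¹ ≈ 1#
    a*a⁻¹≈1 = proj₂ (inverse a a≉0)

    a⁻¹*a≈1 : a⁻¹ * a ≈ 1#
    a⁻¹*a≈1 = trans (*-comm a⁻¹ a) a*a⁻¹≈1

    reduce : Equation (suc m) → Equation (suc m)
    reduce e j = (head r ⊛ e j) ⊝ (head e ⊛ r j)

    ⟦reduce⟧ : ∀ e j → ⟦ reduce e j ⟧ ≈ a * ⟦ e j ⟧ + (- ⟦ head e ⟧) * ⟦ r j ⟧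
    ⟦reduce⟧ e j = begin
      ⟦ reduce e j ⟧
        ≈⟨ ⟦⟧-homo-- (head r ⊛ e j) (head e ⊛ r j) ⟩
      ⟦ head r ⊛ e j ⟧ - ⟦ head e ⊛ r j ⟧
        ≈⟨ +-cong (⟦⟧-homo-* (head r) (e j)) (-‿cong (⟦⟧-homo-* (head e) (r j))) ⟩
      a * ⟦ e j ⟧ - ⟦ head e ⟧ * ⟦ r j ⟧
        ≈⟨ +-congˡ (-‿distribˡ-* ⟦ head e ⟧ ⟦ r j ⟧) ⟩
      a * ⟦ e j ⟧ + (- ⟦ head e ⟧) * ⟦ r j ⟧ ∎

    ⟦reduce⟧-head : ∀ e → ⟦ reduce e zero ⟧ ≈ 0#
    ⟦reduce⟧-head e = begin
      ⟦ reduce e zero ⟧                 ≈⟨ ⟦reduce⟧ e zero ⟩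
      a * ⟦ head e ⟧ + (- ⟦ head e ⟧) * a  ≈⟨ +-cong (*-comm ⟦ head e ⟧ a) (-‿distribˡ-* ⟦ head e ⟧ a) ⟨
      ⟦ head e ⟧ * a - ⟦ head e ⟧ * a      ≈⟨ -‿inverseʳ (⟦ head e ⟧ * a) ⟩
      0#                                ∎

    ⊙-reduce : ∀ e v → r ⊙ v ≈ 0# → tail (reduce e) ⊙ tail v ≈ a * e ⊙ v
    ⊙-reduce e v r⊙v≈0 = begin
      tail (reduce e) ⊙ tail v
        ≈⟨ +-identityˡ _ ⟨
      0# + tail (reduce e) ⊙ tail v
        ≈⟨ +-congʳ (trans (*-congʳ (⟦reduce⟧-head e)) (zeroˡ (head v))) ⟨
      reduce e ⊙ v
        ≈⟨ sum-cong-≋ term ⟩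
      ∑[ j < suc m ] (a * (⟦ e j ⟧ * v j) + (- ⟦ head e ⟧) * (⟦ r j ⟧ * v j))
        ≈⟨ ∑-linear a (- ⟦ head e ⟧) (λ j → ⟦ e j ⟧ * v j) (λ j → ⟦ r j ⟧ * v j) ⟩
      a * e ⊙ v + (- ⟦ head e ⟧) * r ⊙ v
        ≈⟨ +-congˡ (trans (*-congˡ r⊙v≈0) (zeroʳ _)) ⟩
      a * e ⊙ v + 0#
        ≈⟨ +-identityʳ _ ⟩
      a * e ⊙ v ∎
      where
      term : ∀ j → ⟦ reduce e j ⟧ * v j ≈ a * (⟦ e j ⟧ * v j) + (- ⟦ head e ⟧) * (⟦ r j ⟧ * v j)
      term j = trans (*-congʳ (⟦reduce⟧ e j))
                     (trans (distribʳ (v j) _ _) (+-cong (*-assoc _ _ _) (*-assoc _ _ _)))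

    reduced : List (Equation m)
    reduced = map (tail ∘ reduce) E

    ⟦reduce⟧-vanishes : ∀ e j → ⟦ e j ⟧ ≈ 0# → ⟦ head e ⟧ * ⟦ r j ⟧ ≈ 0# → ⟦ reduce e j ⟧ ≈ 0#
    ⟦reduce⟧-vanishes e j e≈0 hr≈0 = begin
      ⟦ reduce e j ⟧                             ≈⟨ ⟦reduce⟧ e j ⟩
      a * ⟦ e j ⟧ + (- ⟦ head e ⟧) * ⟦ r j ⟧     ≈⟨ +-cong (*-congˡ e≈0) (sym (-‿distribˡ-* _ _)) ⟩
      a * 0# - ⟦ head e ⟧ * ⟦ r j ⟧              ≈⟨ +-cong (zeroʳ a) (trans (-‿cong hr≈0) -0#≈0#) ⟩
      0# + 0#                                    ≈⟨ +-identityʳ 0# ⟩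
      0#                                         ∎

    κr : A
    κr = proj₁ (supported-E r∈E)

    r-supported : SupportedOn cl κr (⟦_⟧ ∘ r)
    r-supported = proj₂ (supported-E r∈E)

    cl-head≡κr : head cl ≡ κr
    cl-head≡κr = class-of-nonzero r-supported zero a≉0

    -- An equation involving the first unknown lies in the class of that unknown, as does r,
    -- so the row operation does not mix classes.
    reduced-supported : ∀ {e′} → e′ ∈ reduced → ∃[ κ ] SupportedOn (tail cl) κ (⟦_⟧ ∘ e′)
    reduced-supported e′∈ with ∈-map⁻ (tail ∘ reduce) e′∈
    ... | e , e∈E , ≡.refl with supported-E e∈E | isZero? (head e)
    ...   | κ , supp | yes head-zero = κ , λ j cl≢κ →
              ⟦reduce⟧-vanishes e (suc j) (supp (suc j) cl≢κ) (trans (*-congʳ (⟦⟧-zero head-zero)) (zeroˡ _))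
    ...   | κ , supp | no head-nonzero = κr , λ j cl≢κr →
              ⟦reduce⟧-vanishes e (suc j) (supp (suc j) (cl≢κr ∘ ≡.subst (tail cl j ≡_) κ≡κr))
                (trans (*-congˡ (r-supported (suc j) cl≢κr)) (zeroʳ _))
      where
      κ≡κr : κ ≡ κr
      κ≡κr = ≡.trans (≡.sym (class-of-nonzero supp zero (⟦⟧-nonzero cz head-nonzero))) cl-head≡κr

    solveHead : Vector Carrier m → Carrier
    solveHead w = (- a⁻¹) * tail r ⊙ w

    lift : Vector Carrier m → Vector Carrier (suc m)
    lift w zero    = solveHead w
    lift w (suc j) = w j

    r⊙lift≈0 : ∀ w → r ⊙ lift w ≈ 0#
    r⊙lift≈0 w = begin
      a * ((- a⁻¹) * D) + D   ≈⟨ +-congʳ (*-assoc a (- a⁻¹) D) ⟨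
      (a * - a⁻¹) * D + D     ≈⟨ +-congʳ (*-congʳ (-‿distribʳ-* a a⁻¹)) ⟨
      - (a * a⁻¹) * D + D     ≈⟨ +-congʳ (*-congʳ (-‿cong a*a⁻¹≈1)) ⟩
      - 1# * D + D            ≈⟨ +-congʳ (-1*x≈-x D) ⟩
      - D + D                 ≈⟨ -‿inverseˡ D ⟩
      0#                      ∎
      where
      D : Carrier
      D = tail r ⊙ w

    head-determined : ∀ v → r ⊙ v ≈ 0# → head v ≈ solveHead (tail v)
    head-determined v r⊙v≈0 = begin
      head v                    ≈⟨ *-identityˡ (head v) ⟨
      1# * head v               ≈⟨ *-congʳ a⁻¹*a≈1 ⟨
      (a⁻¹ * a) * head v        ≈⟨ *-assoc a⁻¹ a (head v) ⟩
      a⁻¹ * (a * head v)        ≈⟨ *-congˡ (+-inverseˡ-unique (a * head v) D r⊙v≈0) ⟩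
      a⁻¹ * - D                 ≈⟨ -‿distribʳ-* a⁻¹ D ⟨
      - (a⁻¹ * D)               ≈⟨ -‿distribˡ-* a⁻¹ D ⟩
      (- a⁻¹) * D               ∎
      where
      D : Carrier
      D = tail r ⊙ tail v

    solveHead-cong : ∀ {w w′} → (∀ j → w j ≈ w′ j) → solveHead w ≈ solveHead w′
    solveHead-cong w≈w′ = *-congˡ (sum-cong-≋ (λ j → *-congˡ (w≈w′ j)))

    solveHead-combination : ∀ {d} λs (b : Fin d → Vector Carrier m) →
                            solveHead (combination λs b) ≈ ∑[ i < d ] (λs i * solveHead (b i))
    solveHead-combination {d} λs b = begin
      (- a⁻¹) * tail r ⊙ combination λs b
        ≈⟨ *-congˡ (⊙-combination (tail r) λs b) ⟩
      (- a⁻¹) * ∑[ i < d ] (λs i * tail r ⊙ b i)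
        ≈⟨ *-distribˡ-sum (- a⁻¹) (λ i → λs i * tail r ⊙ b i) ⟩
      ∑[ i < d ] ((- a⁻¹) * (λs i * tail r ⊙ b i))
        ≈⟨ sum-cong-≋ (λ i → x*[y*z]≈y*[x*z] (- a⁻¹) (λs i) _) ⟩
      ∑[ i < d ] (λs i * solveHead (b i)) ∎

    solveHead-supported : ∀ {w} j₀ → SupportedOn (tail cl) (tail cl j₀) w →
                          head cl ≢ tail cl j₀ → solveHead w ≈ 0#
    solveHead-supported {w} j₀ w-supp cl≢ = trans (*-congˡ (sum-zero term)) (zeroʳ _)
      where
      term : ∀ j → ⟦ tail r j ⟧ * w j ≈ 0#
      term j with tail cl j ≟A κr
      ... | yes eq  =
        trans (*-congˡ (w-supp j (λ eq′ → cl≢ (≡.trans cl-head≡κr (≡.trans (≡.sym eq) eq′))))) (zeroʳ _)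
      ... | no  neq = trans (*-congʳ (r-supported (suc j) neq)) (zeroˡ _)

    lift-solves : ∀ {w} → Solves reduced w → Solves E (lift w)
    lift-solves {w} w-solves {e} e∈E = x≉0∧x*y≈0⇒y≈0 a≉0
      (trans (sym (⊙-reduce e (lift w) (r⊙lift≈0 w))) (w-solves (∈-map⁺ (tail ∘ reduce) e∈E)))

    tail-solves : ∀ {v} → Solves E v → Solves reduced (tail v)
    tail-solves {v} v-solves e′∈ with ∈-map⁻ (tail ∘ reduce) e′∈
    ... | e , e∈E , ≡.refl =
      trans (⊙-reduce e v (v-solves r∈E)) (trans (*-congˡ (v-solves e∈E)) (zeroʳ a))

    module _ (B : SolutionBasis (tail cl) reduced) where
      open SolutionBasis B

      basis′ : Fin dim → Vector Carrier (suc m)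
      basis′ i = lift (basis i)

      spans′ : ∀ v → Solves E v → ∃[ λs ] (∀ j → v j ≈ combination λs basis′ j)
      spans′ v v-solves with spans (tail v) (tail-solves {v} v-solves)
      ... | μ , μ-spans = μ , λ where
          zero    → trans (head-determined v (v-solves r∈E))
                      (trans (solveHead-cong μ-spans) (solveHead-combination μ basis))
          (suc j) → μ-spans j

      supported′ : ∀ i → ∃[ j₀ ] SupportedOn cl (cl j₀) (basis′ i)
      supported′ i = let j₀ , supp = supported i in suc j₀ , λ where
        zero    cl≢ → solveHead-supported j₀ supp cl≢
        (suc j) cl≢ → supp j cl≢

      result : SolutionBasis cl E
      result = record
        { dim = dim ; basis = basis′ ; solves = λ i → lift-solves (solves i)
        ; independent = λ λs comb≈0 → independent λs (comb≈0 ∘ suc)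
        ; spans = spans′ ; supported = supported′ }

  solutionBasis : ∀ {m} (cl : Vector A m) (E : List (Equation m)) →
                  (∀ {e} → e ∈ E → ∃[ κ ] SupportedOn cl κ (⟦_⟧ ∘ e)) → SolutionBasis cl E
  solutionBasis {zero} cl E _ = record
    { dim = 0 ; basis = λ () ; solves = λ () ; independent = λ _ _ ()
    ; spans = λ _ _ → (λ ()) , (λ ()) ; supported = λ () }
  solutionBasis {suc m} cl E supported-E with any? (¬? ∘ isZero? ∘ head) E
  ... | yes has-pivot =
    let r , r∈E , pivot = find has-pivot
        open EliminateFirstUnknown cl E supported-E r∈E pivot
    in result (solutionBasis (tail cl) reduced reduced-supported)
  ... | no no-pivot = FreeFirstUnknown.result cl E free
        (solutionBasis (tail cl) (map tail E) tail-supported)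
    where
    free : ∀ {e} → e ∈ E → IsZero (head e)
    free e∈E = decidable-stable (isZero? _) (no-pivot ∘ lose e∈E)
    tail-supported : ∀ {e′} → e′ ∈ map tail E → ∃[ κ ] SupportedOn (tail cl) κ (⟦_⟧ ∘ e′)
    tail-supported e′∈ with ∈-map⁻ tail e′∈
    ... | e , e∈E , ≡.refl = let κ , supp = supported-E e∈E in κ , supp ∘ suc

  basis-nonzero : ∀ {m} {cl : Vector A m} {E} (B : SolutionBasis cl E) →
                  let open SolutionBasis B in ∀ i → ¬ (∀ j → basis i j ≈ 0#)
  basis-nonzero B i basis≈0 = 0≉1 (sym (trans (sym (𝟙-yes (i ≟ i) ≡.refl)) (independent δ comb≈0 i)))
    where
    open SolutionBasis B
    δ : Vector Carrier dim
    δ k = 𝟙 (k ≟ i)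
    comb≈0 : ∀ j → combination δ basis j ≈ 0#
    comb≈0 j = sum-zero term
      where
      term : ∀ k → δ k * basis k j ≈ 0#
      term k with k ≟ i
      ... | yes ≡.refl = trans (*-congˡ (basis≈0 j)) (zeroʳ _)
      ... | no  _      = zeroˡ _

splitStep : ℕ → Comp × Comp → List (Comp × Comp)
splitStep a (l , r) = (a ∷ l , r) ∷ (l , a ∷ r) ∷ []

splits-↭ : ∀ α {p} → p ∈ splits α → α ↭ proj₁ p ++ proj₂ p
splits-↭ []      (here ≡.refl) = ↭-refl
splits-↭ (a ∷ α) p∈ with find (∈-concatMap⁻ (splitStep a) {xs = splits α} p∈)
... | (l , r) , q∈ , here ≡.refl         = prep a (splits-↭ α q∈)
... | (l , r) , q∈ , there (here ≡.refl) = ↭-trans (prep a (splits-↭ α q∈)) (↭-sym (shift a l r))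

primitiveTerms : Comp → List (Comp × Comp)
primitiveTerms α = (α , []) ∷ ([] , α) ∷ []

primitiveTerms-↭ : ∀ α {p} → p ∈ primitiveTerms α → α ↭ proj₁ p ++ proj₂ p
primitiveTerms-↭ α (here ≡.refl)         = ↭-reflexive (≡.sym (++-identityʳ α))
primitiveTerms-↭ α (there (here ≡.refl)) = ↭-refl

multiplicity : Comp × Comp → List (Comp × Comp) → ℕ
multiplicity p []      = 0
multiplicity p (q ∷ L) with q ≟T p
... | yes _ = suc (multiplicity p L)
... | no  _ = multiplicity p L

multiplicity-∉ : ∀ {p} L → p ∉ L → multiplicity p L ≡ 0
multiplicity-∉ []            _   = ≡.refl
multiplicity-∉ {p} (q ∷ L) p∉ with q ≟T p
... | yes q≡p = ⊥-elim (p∉ (here (≡.sym q≡p)))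
... | no  _   = multiplicity-∉ L (p∉ ∘ there)

reducedΔ-coeff : Comp × Comp → Comp → Diff
reducedΔ-coeff p α = multiplicity p (splits α) , multiplicity p (primitiveTerms α)

reducedΔ-pairs : Comp → List (Comp × Comp)
reducedΔ-pairs α = splits α ++ primitiveTerms α

reducedΔ-pairs-↭ : ∀ α {p} → p ∈ reducedΔ-pairs α → α ↭ proj₁ p ++ proj₂ p
reducedΔ-pairs-↭ α p∈ = [ splits-↭ α , primitiveTerms-↭ α ]′ (∈-++⁻ (splits α) p∈)

reducedΔ-coeff-∉ : ∀ {p} α → p ∉ reducedΔ-pairs α → IsZero (reducedΔ-coeff p α)
reducedΔ-coeff-∉ α p∉ = ≡.trans (multiplicity-∉ (splits α) (p∉ ∘ ∈-++⁺ˡ))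
                                (≡.sym (multiplicity-∉ (primitiveTerms α) (p∉ ∘ ∈-++⁺ʳ (splits α))))

reducedΔ-coeff-↭ : ∀ {p} α → ¬ (α ↭ proj₁ p ++ proj₂ p) → IsZero (reducedΔ-coeff p α)
reducedΔ-coeff-↭ α ¬↭ = reducedΔ-coeff-∉ α (¬↭ ∘ reducedΔ-pairs-↭ α)

weight-↭ : ∀ {α β} → α ↭ β → weight α ≡ weight β
weight-↭ α↭β = sum-↭ (↭-map⁺ suc α↭β)

sorted-↭⇒≡ : ∀ {xs ys} → Sorted xs → Sorted ys → xs ↭ ys → xs ≡ ys
sorted-↭⇒≡ xs↗ ys↗ xs↭ys = Pointwise-≡⇒≡ (↗↭↗⇒≋ ℕ.≤-totalOrder xs↗ ys↗ (↭⇒↭ₛ xs↭ys))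

sort-≡ : ∀ {xs ys} → Sorted ys → xs ↭ ys → sort xs ≡ ys
sort-≡ {xs} ys↗ xs↭ys = sorted-↭⇒≡ (sort-↗ xs) ys↗ (↭-trans (sort-↭ xs) xs↭ys)

sort-cong-↭ : ∀ {xs ys} → xs ↭ ys → sort xs ≡ sort ys
sort-cong-↭ {ys = ys} xs↭ys = sort-≡ (sort-↗ ys) (↭-trans xs↭ys (↭-sym (sort-↭ ys)))

compositionStep : Comp → List Comp
compositionStep []      = (0 ∷ []) ∷ []
compositionStep (a ∷ α) = (suc a ∷ α) ∷ (0 ∷ a ∷ α) ∷ []

candidates : ℕ → List Comp
candidates zero    = [] ∷ []
candidates (suc n) = concatMap compositionStep (candidates n)

candidates-complete : ∀ n α → weight α ≡ n → α ∈ candidates n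
candidates-complete zero    []      _ = here ≡.refl
candidates-complete (suc n) (suc a ∷ α) eq =
  ∈-concatMap⁺ compositionStep (lose (candidates-complete n (a ∷ α) (ℕ.suc-injective eq)) (here ≡.refl))
candidates-complete (suc n) (zero ∷ []) eq =
  ∈-concatMap⁺ compositionStep (lose (candidates-complete n [] (ℕ.suc-injective eq)) (here ≡.refl))
candidates-complete (suc n) (zero ∷ b ∷ α) eq =
  ∈-concatMap⁺ compositionStep (lose (candidates-complete n (b ∷ α) (ℕ.suc-injective eq)) (there (here ≡.refl)))

lookup-injective : ∀ {A : Set} {xs : List A} → Unique xs → ∀ i j → lookup xs i ≡ lookup xs j → i ≡ j
lookup-injective (_ ∷ _)        zero    zero    _  = ≡.refl
lookup-injective (x∉xs ∷ _)     zero    (suc j) eq = ⊥-elim (All.lookup x∉xs (∈-lookup j) eq)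
lookup-injective (x∉xs ∷ _)     (suc i) zero    eq = ⊥-elim (All.lookup x∉xs (∈-lookup i) (≡.sym eq))
lookup-injective (_ ∷ xs-unique) (suc i) (suc j) eq = ≡.cong suc (lookup-injective xs-unique i j eq)

module CompositionsOfWeight (n : ℕ) where

  hasWeight? : ∀ α → Dec (weight α ≡ n)
  hasWeight? α = weight α ℕ.≟ n

  -- Filtering and deduplicating spare us proving that candidates n lists exactly the
  -- compositions of weight n, each once.
  compositions : List Comp
  compositions = deduplicate _≟C_ (filter hasWeight? (candidates n))

  count : ℕ
  count = length compositions

  composition : Fin count → Comp
  composition = lookup compositions

  composition-injective : ∀ i j → composition i ≡ composition j → i ≡ j
  composition-injective = lookup-injective (deduplicate-! (filter hasWeight? (candidates n)))

  ∈-compositions⇒weight : ∀ {α} → α ∈ compositions → weight α ≡ n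
  ∈-compositions⇒weight α∈ = proj₂ (∈-filter⁻ hasWeight? {xs = candidates n} (∈-deduplicate⁻ _≟C_ _ α∈))

  weight-composition : ∀ j → weight (composition j) ≡ n
  weight-composition j = ∈-compositions⇒weight (∈-lookup j)

  composition-surjective : ∀ {α} → weight α ≡ n → ∃[ j ] composition j ≡ α
  composition-surjective {α} wα≡n = index α∈ , ≡.sym (lookup-index α∈)
    where
    α∈ : α ∈ compositions
    α∈ = ∈-deduplicate⁺ _≟C_ (∈-filter⁺ hasWeight? (candidates-complete n α wα≡n) wα≡n)

module ISPWProperties {c ℓ} (K : Field c ℓ) where
  open Field K hiding (zero)
  open ISPW K
  open FieldProperties K
  open SumProperties semiring
  open import Algebra.Properties.Ring ring using (-‿distribʳ-*; -0#≈0#)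
  open import Algebra.Properties.AbelianGroup +-abelianGroup
    using (⁻¹-∙-comm; x≈y⇒x∙y⁻¹≈ε; x∙y⁻¹≈ε⇒x≈y)
  open import Algebra.Properties.CommutativeSemigroup +-commutativeSemigroup using (interchange)
  open import Relation.Binary.Reasoning.Setoid setoid

  extend : (Comp → Carrier) → Elt → Carrier
  extend f []            = 0#
  extend f ((a , α) ∷ x) = a * f α + extend f x

  extend-cong : ∀ {f g} x → (∀ α → f α ≈ g α) → extend f x ≈ extend g x
  extend-cong []            f≈g = refl
  extend-cong ((a , α) ∷ x) f≈g = +-cong (*-congˡ (f≈g α)) (extend-cong x f≈g)

  extend-+ : ∀ f g x → extend (λ α → f α + g α) x ≈ extend f x + extend g x
  extend-+ f g []            = sym (+-identityˡ 0#)
  extend-+ f g ((a , α) ∷ x) = begin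
    a * (f α + g α) + extend (λ β → f β + g β) x
      ≈⟨ +-cong (distribˡ a (f α) (g α)) (extend-+ f g x) ⟩
    (a * f α + a * g α) + (extend f x + extend g x)
      ≈⟨ interchange _ _ _ _ ⟩
    (a * f α + extend f x) + (a * g α + extend g x) ∎

  extend-- : ∀ f x → extend (λ α → - f α) x ≈ - extend f x
  extend-- f []            = sym -0#≈0#
  extend-- f ((a , α) ∷ x) = begin
    a * - f α + extend (λ β → - f β) x   ≈⟨ +-cong (-‿distribʳ-* a (f α)) (sym (extend-- f x)) ⟨
    - (a * f α) + - extend f x           ≈⟨ ⁻¹-∙-comm _ _ ⟩
    - (a * f α + extend f x)             ∎

  extend-++ : ∀ f x y → extend f (x ++ y) ≈ extend f x + extend f y
  extend-++ f []            y = sym (+-identityˡ _)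
  extend-++ f ((a , α) ∷ x) y = trans (+-congˡ (extend-++ f x y)) (sym (+-assoc _ _ _))

  extend-· : ∀ f b x → extend f (b · x) ≈ b * extend f x
  extend-· f b []            = sym (zeroʳ b)
  extend-· f b ((a , α) ∷ x) = begin
    (b * a) * f α + extend f (b · x)     ≈⟨ +-cong (*-assoc b a (f α)) (extend-· f b x) ⟩
    b * (a * f α) + b * extend f x       ≈⟨ distribˡ b _ _ ⟨
    b * (a * f α + extend f x)           ∎

  extend-tabulate : ∀ {k} f (g : Fin k → Carrier × Comp) →
                    extend f (tabulate g) ≈ ∑[ j < k ] (proj₁ (g j) * f (proj₂ (g j)))
  extend-tabulate {zero}  f g = refl
  extend-tabulate {suc k} f g = +-congˡ (extend-tabulate f (g ∘ suc))

  extend-concatMap-tabulate : ∀ {A : Set} {k} f (h : A → Elt) (g : Fin k → A) →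
                              extend f (concatMap h (tabulate g)) ≈ ∑[ i < k ] extend f (h (g i))
  extend-concatMap-tabulate {k = zero}  f h g = refl
  extend-concatMap-tabulate {k = suc k} f h g =
    trans (extend-++ f (h (g zero)) _) (+-congˡ (extend-concatMap-tabulate f h (g ∘ suc)))

  extend-lincomb : ∀ {d} f (λs : Fin d → Carrier) (e : Fin d → Elt) →
                   extend f (lincomb λs e) ≈ ∑[ i < d ] (λs i * extend f (e i))
  extend-lincomb f λs e = trans (extend-concatMap-tabulate f (λ i → λs i · e i) (λ i → i))
                                (sum-cong-≋ (λ i → extend-· f (λs i) (e i)))

  coeff≈extend : ∀ x α → coeff x α ≈ extend (λ β → 𝟙 (β ≟C α)) x
  coeff≈extend []            α = refl
  coeff≈extend ((a , β) ∷ x) α with β ≟C α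
  ... | yes _ = +-cong (sym (*-identityʳ a)) (coeff≈extend x α)
  ... | no  _ = trans (coeff≈extend x α) (trans (sym (+-identityˡ _)) (+-congʳ (sym (zeroʳ a))))

  coeff-∷ : ∀ a β x α → coeff ((a , β) ∷ x) α ≈ a * 𝟙 (β ≟C α) + coeff x α
  coeff-∷ a β x α with β ≟C α
  ... | yes _ = +-congʳ (sym (*-identityʳ a))
  ... | no  _ = trans (sym (+-identityˡ _)) (+-congʳ (sym (zeroʳ a)))

  coeff⊗-++ : ∀ s t p → coeff⊗ (s ++ t) p ≈ coeff⊗ s p + coeff⊗ t p
  coeff⊗-++ []            t p = sym (+-identityˡ _)
  coeff⊗-++ ((a , q) ∷ s) t p with q ≟T p
  ... | yes _ = trans (+-congˡ (coeff⊗-++ s t p)) (sym (+-assoc _ _ _))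
  ... | no  _ = coeff⊗-++ s t p

  coeff⊗-map-pair : ∀ a L p → coeff⊗ (map (a ,_) L) p ≈ a * fromℕ (multiplicity p L)
  coeff⊗-map-pair a []      p = sym (zeroʳ a)
  coeff⊗-map-pair a (q ∷ L) p with q ≟T p
  ... | yes _ = trans (+-cong (sym (*-identityʳ a)) (coeff⊗-map-pair a L p)) (sym (distribˡ a _ _))
  ... | no  _ = coeff⊗-map-pair a L p

  coeff⊗-concatMap : ∀ (g : Comp → List (Comp × Comp)) x p →
    coeff⊗ (concatMap (λ t → map (proj₁ t ,_) (g (proj₂ t))) x) p
      ≈ extend (λ α → fromℕ (multiplicity p (g α))) x
  coeff⊗-concatMap g []            p = refl
  coeff⊗-concatMap g ((a , α) ∷ x) p =
    trans (coeff⊗-++ (map (a ,_) (g α)) _ p)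
          (+-cong (coeff⊗-map-pair a (g α) p) (coeff⊗-concatMap g x p))

  coeff⊗-map : ∀ (g : Comp → Comp × Comp) x p →
    coeff⊗ (map (λ t → proj₁ t , g (proj₂ t)) x) p ≈ extend (λ α → 𝟙 (g α ≟T p)) x
  coeff⊗-map g []            p = refl
  coeff⊗-map g ((a , α) ∷ x) p with g α ≟T p
  ... | yes _ = +-cong (sym (*-identityʳ a)) (coeff⊗-map g x p)
  ... | no  _ = trans (coeff⊗-map g x p) (trans (sym (+-identityˡ _)) (+-congʳ (sym (zeroʳ a))))

  fromℕ-multiplicity-∷ : ∀ p q L → fromℕ (multiplicity p (q ∷ L)) ≈ 𝟙 (q ≟T p) + fromℕ (multiplicity p L)
  fromℕ-multiplicity-∷ p q L with q ≟T p
  ... | yes _ = refl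
  ... | no  _ = sym (+-identityˡ _)

  coeff⊗-Δ : ∀ x p → coeff⊗ (Δ x) p ≈ extend (λ α → fromℕ (multiplicity p (splits α))) x
  coeff⊗-Δ = coeff⊗-concatMap splits

  coeff⊗-prim-rhs : ∀ x p → coeff⊗ (prim-rhs x) p ≈ extend (λ α →
                    fromℕ (multiplicity p (primitiveTerms α))) x
  coeff⊗-prim-rhs x p = begin
    coeff⊗ (prim-rhs x) p
      ≈⟨ coeff⊗-++ (map _ x) (map _ x) p ⟩
    coeff⊗ (map _ x) p + coeff⊗ (map _ x) p
      ≈⟨ +-cong (coeff⊗-map (_, []) x p) (coeff⊗-map ([] ,_) x p) ⟩
    extend (λ α → 𝟙 ((α , []) ≟T p)) x + extend (λ α → 𝟙 (([] , α) ≟T p)) x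
                                                                   ≈⟨ extend-+ _ _ x ⟨
    extend (λ α → 𝟙 ((α , []) ≟T p) + 𝟙 (([] , α) ≟T p)) x
      ≈⟨ extend-cong x (λ α → sym (primitiveTerms-count α)) ⟩
    extend (λ α → fromℕ (multiplicity p (primitiveTerms α))) x ∎
    where
    primitiveTerms-count : ∀ α →
                           fromℕ (multiplicity p (primitiveTerms α)) ≈ 𝟙 ((α , []) ≟T p) + 𝟙 (([] , α) ≟T p)
    primitiveTerms-count α = trans (fromℕ-multiplicity-∷ p (α , []) _)
      (+-congˡ (trans (fromℕ-multiplicity-∷ p ([] , α) []) (+-identityʳ _)))

  coeff⊗-reducedΔ : ∀ x p → coeff⊗ (Δ x) p - coeff⊗ (prim-rhs x) p ≈ extend (⟦_⟧ ∘ reducedΔ-coeff p) x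
  coeff⊗-reducedΔ x p = begin
    coeff⊗ (Δ x) p - coeff⊗ (prim-rhs x) p    ≈⟨ +-cong (coeff⊗-Δ x p) (-‿cong (coeff⊗-prim-rhs x p)) ⟩
    extend S x - extend P x                   ≈⟨ +-congˡ (extend-- P x) ⟨
    extend S x + extend (λ α → - P α) x       ≈⟨ extend-+ S (λ α → - P α) x ⟨
    extend (⟦_⟧ ∘ reducedΔ-coeff p) x         ∎
    where
    S P : Comp → Carrier
    S α = fromℕ (multiplicity p (splits α))
    P α = fromℕ (multiplicity p (primitiveTerms α))

  primitive⇒reducedΔ≈0 : ∀ x → Primitive x → ∀ p → extend (⟦_⟧ ∘ reducedΔ-coeff p) x ≈ 0#
  primitive⇒reducedΔ≈0 x prim p = trans (sym (coeff⊗-reducedΔ x p)) (x≈y⇒x∙y⁻¹≈ε (prim p))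

  reducedΔ≈0⇒primitive : ∀ x → (∀ p → extend (⟦_⟧ ∘ reducedΔ-coeff p) x ≈ 0#) → Primitive x
  reducedΔ≈0⇒primitive x vanishes p = x∙y⁻¹≈ε⇒x≈y _ _ (trans (coeff⊗-reducedΔ x p) (vanishes p))

  InPermSpan-disjoint : ∀ {p q x} → Sorted p → Sorted q → p ≢ q →
                        InPermSpan p x → InPermSpan q x → ∀ α → coeff x α ≈ 0#
  InPermSpan-disjoint {p} {q} p↗ q↗ p≢q in-p in-q α with sort α ≟C p
  ... | yes sortα≡p = in-q α (λ α↭q → p≢q (≡.trans (≡.sym sortα≡p) (sort-≡ q↗ α↭q)))
  ... | no  sortα≢p = in-p α (sortα≢p ∘ sort-≡ p↗)

module PrimitiveBasis {c ℓ} (K : Field c ℓ) (cz : CharZero K) (n : ℕ) where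
  open Field K hiding (zero)
  open ISPW K
  open FieldProperties K
  open SumProperties semiring
  open ISPWProperties K
  open LinearSystems K cz _≟C_
  open CompositionsOfWeight n
  open import Relation.Binary.Reasoning.Setoid setoid

  toElt : Vector Carrier count → Elt
  toElt v = tabulate (λ j → v j , composition j)

  coeff-toElt : ∀ v α → coeff (toElt v) α ≈ ∑[ j < count ] (v j * 𝟙 (composition j ≟C α))
  coeff-toElt v α = trans (coeff≈extend (toElt v) α) (extend-tabulate _ (λ j → v j , composition j))

  coeff-toElt-composition : ∀ v j₀ → coeff (toElt v) (composition j₀) ≈ v j₀
  coeff-toElt-composition v j₀ = begin
    coeff (toElt v) (composition j₀)
      ≈⟨ coeff-toElt v (composition j₀) ⟩
    ∑[ j < count ] (v j * 𝟙 (composition j ≟C composition j₀))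
      ≈⟨ sum-δ _ j₀ off-diagonal ⟩
    v j₀ * 𝟙 (composition j₀ ≟C composition j₀)
      ≈⟨ *-congˡ (𝟙-yes (composition j₀ ≟C _) ≡.refl) ⟩
    v j₀ * 1#
      ≈⟨ *-identityʳ (v j₀) ⟩
    v j₀ ∎
    where
    off-diagonal : ∀ j → j ≢ j₀ → v j * 𝟙 (composition j ≟C composition j₀) ≈ 0#
    off-diagonal j j≢j₀ =
      trans (*-congˡ (𝟙-no (composition j ≟C _) (j≢j₀ ∘ composition-injective j j₀))) (zeroʳ (v j))

  toElt-homogeneous : ∀ v → Homogeneous n (toElt v)
  toElt-homogeneous v α wα≢n = trans (coeff-toElt v α) (sum-zero term)
    where
    term : ∀ j → v j * 𝟙 (composition j ≟C α) ≈ 0#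
    term j = trans (*-congˡ (𝟙-no (composition j ≟C α) (λ { ≡.refl → wα≢n (weight-composition j) })))
                   (zeroʳ (v j))

  VanishesOffWeight : (Comp → Carrier) → Set ℓ
  VanishesOffWeight f = ∀ α → weight α ≢ n → f α ≈ 0#

  expand-in-compositions : ∀ f → VanishesOffWeight f → ∀ α →
           f α ≈ ∑[ j < count ] (𝟙 (α ≟C composition j) * f (composition j))
  expand-in-compositions f f-vanishes α with weight α ℕ.≟ n
  ... | yes wα≡n = let j₀ , sj₀≡α = composition-surjective wα≡n in begin
    f α
      ≈⟨ *-identityˡ (f α) ⟨
    1# * f α
      ≈⟨ *-congʳ (𝟙-yes (α ≟C α) ≡.refl) ⟨
    𝟙 (α ≟C α) * f α
      ≡⟨ ≡.cong (λ β → 𝟙 (α ≟C β) * f β) sj₀≡α ⟨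
    𝟙 (α ≟C composition j₀) * f (composition j₀)
      ≈⟨ sum-δ _ j₀ (off-diagonal j₀ sj₀≡α) ⟨
    ∑[ j < count ] (𝟙 (α ≟C composition j) * f (composition j)) ∎
    where
    off-diagonal : ∀ j₀ → composition j₀ ≡ α → ∀ j → j ≢ j₀ →
                   𝟙 (α ≟C composition j) * f (composition j) ≈ 0#
    off-diagonal j₀ sj₀≡α j j≢j₀ = trans (*-congʳ (𝟙-no (α ≟C _)
      (λ α≡sj → j≢j₀ (composition-injective j j₀ (≡.trans (≡.sym α≡sj) (≡.sym sj₀≡α)))))) (zeroˡ _)
  ... | no  wα≢n = trans (f-vanishes α wα≢n) (sym (sum-zero term))
    where
    term : ∀ j → 𝟙 (α ≟C composition j) * f (composition j) ≈ 0#
    term j = trans (*-congʳ (𝟙-no (α ≟C _) (λ { ≡.refl → wα≢n (weight-composition j) }))) (zeroˡ _)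

  extend-grouped : ∀ f → VanishesOffWeight f → ∀ x →
                   extend f x ≈ ∑[ j < count ] (coeff x (composition j) * f (composition j))
  extend-grouped f f-vanishes []            = sym (sum-zero (λ j → zeroˡ (f (composition j))))
  extend-grouped f f-vanishes ((a , α) ∷ x) = begin
    a * f α + extend f x
      ≈⟨ +-cong (*-congˡ (expand-in-compositions f f-vanishes α)) (extend-grouped f f-vanishes x) ⟩
    a * ∑[ j < count ] (𝟙 (α ≟C s j) * f (s j)) + ∑[ j < count ] (coeff x (s j) * f (s j))
      ≈⟨ +-congʳ (*-distribˡ-sum a (λ j → 𝟙 (α ≟C s j) * f (s j))) ⟩
    ∑[ j < count ] (a * (𝟙 (α ≟C s j) * f (s j))) + ∑[ j < count ] (coeff x (s j) * f (s j))
      ≈⟨ ∑-distrib-+ (λ j → a * (𝟙 (α ≟C s j) * f (s j))) (λ j → coeff x (s j) * f (s j)) ⟨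
    ∑[ j < count ] (a * (𝟙 (α ≟C s j) * f (s j)) + coeff x (s j) * f (s j))
      ≈⟨ sum-cong-≋ term ⟩
    ∑[ j < count ] (coeff ((a , α) ∷ x) (s j) * f (s j)) ∎
    where
    s : Fin count → Comp
    s = composition
    term : ∀ j →
           a * (𝟙 (α ≟C s j) * f (s j)) + coeff x (s j) * f (s j) ≈ coeff ((a , α) ∷ x) (s j) * f (s j)
    term j = begin
      a * (𝟙 (α ≟C s j) * f (s j)) + coeff x (s j) * f (s j)  ≈⟨ +-congʳ (*-assoc a _ _) ⟨
      (a * 𝟙 (α ≟C s j)) * f (s j) + coeff x (s j) * f (s j)  ≈⟨ distribʳ (f (s j)) _ _ ⟨
      (a * 𝟙 (α ≟C s j) + coeff x (s j)) * f (s j)            ≈⟨ *-congʳ (coeff-∷ a α x (s j)) ⟨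
      coeff ((a , α) ∷ x) (s j) * f (s j)                     ∎

  equation : Comp × Comp → Equation count
  equation p j = reducedΔ-coeff p (composition j)

  relevantPairs : List (Comp × Comp)
  relevantPairs = concatMap reducedΔ-pairs compositions

  system : List (Equation count)
  system = map equation relevantPairs

  class : Vector Comp count
  class j = sort (composition j)

  system-supported : ∀ {e} → e ∈ system → ∃[ κ ] SupportedOn class κ (⟦_⟧ ∘ e)
  system-supported {e} e∈ with ∈-map⁻ equation e∈
  ... | p , _ , ≡.refl = sort (proj₁ p ++ proj₂ p) , λ j class≢ →
    ⟦⟧-zero (reducedΔ-coeff-↭ (composition j) (class≢ ∘ sort-cong-↭))

  equation-⊙ : ∀ p v → equation p ⊙ v ≈ extend (⟦_⟧ ∘ reducedΔ-coeff p) (toElt v)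
  equation-⊙ p v = trans (sum-cong-≋ (λ j → *-comm _ (v j)))
                         (sym (extend-tabulate (⟦_⟧ ∘ reducedΔ-coeff p) (λ j → v j , composition j)))

  relevantPairs-weight : ∀ {p} → p ∈ relevantPairs → weight (proj₁ p ++ proj₂ p) ≡ n
  relevantPairs-weight {p} p∈ with find (∈-concatMap⁻ reducedΔ-pairs {xs = compositions} p∈)
  ... | α , α∈ , p∈α = ≡.trans (≡.sym (weight-↭ (reducedΔ-pairs-↭ α p∈α))) (∈-compositions⇒weight α∈)

  solves⇒primitive : ∀ v → Solves system v → Primitive (toElt v)
  solves⇒primitive v v-solves =
    reducedΔ≈0⇒primitive (toElt v) λ p → trans (sym (equation-⊙ p v)) (equation-holds p)
    where
    equation-holds : ∀ p → equation p ⊙ v ≈ 0#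
    equation-holds p with p ∈? relevantPairs
    ... | yes p∈ = v-solves (∈-map⁺ equation p∈)
    ... | no  p∉ = sum-zero λ j → trans (*-congʳ (⟦⟧-zero (reducedΔ-coeff-∉ (composition j)
                     (p∉ ∘ ∈-concatMap⁺ reducedΔ-pairs {xs = compositions} ∘ lose (∈-lookup j)))))
                     (zeroˡ (v j))

  primitive⇒solves : ∀ x → Primitive x → Solves system (coeff x ∘ composition)
  primitive⇒solves x x-prim e∈ with ∈-map⁻ equation e∈
  ... | p , p∈ , ≡.refl = begin
    equation p ⊙ (coeff x ∘ composition)
      ≈⟨ sum-cong-≋ (λ j → *-comm ⟦ equation p j ⟧ (coeff x (composition j))) ⟩
    ∑[ j < count ] (coeff x (composition j) * ⟦ equation p j ⟧)
      ≈⟨ extend-grouped _ vanishes x ⟨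
    extend (⟦_⟧ ∘ reducedΔ-coeff p) x
      ≈⟨ primitive⇒reducedΔ≈0 x x-prim p ⟩
    0# ∎
    where
    vanishes : VanishesOffWeight (⟦_⟧ ∘ reducedΔ-coeff p)
    vanishes α wα≢n = ⟦⟧-zero (reducedΔ-coeff-↭ α
      (λ α↭ → wα≢n (≡.trans (weight-↭ α↭) (relevantPairs-weight p∈))))

  B : SolutionBasis class system
  B = solutionBasis class system system-supported

  open SolutionBasis B public using (dim)
  open SolutionBasis B hiding (dim)

  primitiveBasis : Fin dim → Elt
  primitiveBasis i = toElt (basis i)

  coeff-lincomb : ∀ λs α →
                  coeff (lincomb λs primitiveBasis) α ≈ ∑[ i < dim ] (λs i * coeff (primitiveBasis i) α)
  coeff-lincomb λs α = trans (coeff≈extend (lincomb λs primitiveBasis) α)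
    (trans (extend-lincomb _ λs primitiveBasis)
           (sum-cong-≋ (λ i → *-congˡ (sym (coeff≈extend (primitiveBasis i) α)))))

  coeff-lincomb-composition : ∀ λs j →
                              coeff (lincomb λs primitiveBasis) (composition j) ≈ combination λs basis j
  coeff-lincomb-composition λs j =
    trans (coeff-lincomb λs (composition j))
          (sum-cong-≋ (λ i → *-congˡ (coeff-toElt-composition (basis i) j)))

  primitiveBasis-spans : ∀ x → InPrim n x → ∃[ λs ] (x ≈E lincomb λs primitiveBasis)
  primitiveBasis-spans x (x-hom , x-prim) with spans (coeff x ∘ composition) (primitive⇒solves x x-prim)
  ... | λs , λs-spans = λs , coeffs-agree
    where
    coeffs-agree : x ≈E lincomb λs primitiveBasis
    coeffs-agree α with weight α ℕ.≟ n
    ... | yes wα≡n with composition-surjective {α} wα≡n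
    ...   | j , ≡.refl = trans (λs-spans j) (sym (coeff-lincomb-composition λs j))
    coeffs-agree α | no wα≢n = trans (x-hom α wα≢n) (sym (trans (coeff-lincomb λs α)
      (sum-zero (λ i → trans (*-congˡ (toElt-homogeneous (basis i) α wα≢n)) (zeroʳ (λs i))))))

  primitiveBasis-isBasis : IsBasisOfPrim n dim primitiveBasis
  primitiveBasis-isBasis =
      (λ i → toElt-homogeneous (basis i) , solves⇒primitive (basis i) (solves i))
    , (λ λs lincomb≈0 → independent λs λ j →
         trans (sym (coeff-lincomb-composition λs j)) (lincomb≈0 (composition j)))
    , primitiveBasis-spans

  partition : Fin dim → Comp
  partition i = class (proj₁ (supported i))

  partition-isPartition : ∀ i → IsPartitionOf (partition i) n
  partition-isPartition i = let j₀ = proj₁ (supported i) in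
    sort-↗ (composition j₀) , ≡.trans (weight-↭ (sort-↭ (composition j₀))) (weight-composition j₀)

  partition-span : ∀ i → InPermSpan (partition i) (primitiveBasis i)
  partition-span i α ¬α↭ = trans (coeff-toElt (basis i) α) (sum-zero term)
    where
    term : ∀ j → basis i j * 𝟙 (composition j ≟C α) ≈ 0#
    term j with composition j ≟C α
    ... | yes ≡.refl = trans (*-congʳ (proj₂ (supported i) j
                         (λ class≡ → ¬α↭ (↭-trans (↭-sym (sort-↭ α)) (↭-reflexive class≡))))) (zeroˡ _)
    ... | no  _      = zeroʳ (basis i j)

  partition-unique : ∀ i q → IsPartitionOf q n × InPermSpan q (primitiveBasis i) → q ≡ partition i
  partition-unique i q ((q↗ , _) , q-span) with q ≟C partition i
  ... | yes q≡ = q≡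
  ... | no  q≢ = ⊥-elim (basis-nonzero B i λ j → trans (sym (coeff-toElt-composition (basis i) j))
          (InPermSpan-disjoint {x = primitiveBasis i} q↗ (sort-↗ _) q≢ q-span (partition-span i)
                               (composition j)))

mainTheorem5 : ∀ {c ℓ} (K : Field c ℓ) → CharZero K →
    let open ISPW K in
    (n : ℕ) → 1 ≤ n →
    ∃[ d ] ∃[ e ] (IsBasisOfPrim n d e ×
      (∀ (i : Fin d) → ∃[ p ] ((IsPartitionOf p n × InPermSpan p (e i))
        × (∀ q → IsPartitionOf q n × InPermSpan q (e i) → q ≡ p))))
mainTheorem5 K cz n _ =
  dim , primitiveBasis , primitiveBasis-isBasis ,
  λ i → partition i , (partition-isPartition i , partition-span i) , partition-unique i
  where open PrimitiveBasis K cz n
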